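{- Let $k$ be a positive integer. Every directed graph $G$ can be edge-decomposed into $k$ factors $G_1,\ldots,G_k$ such that for each $i$ with $1\le i\le k$ and each vertex $v$, $$|d^+_{G_i}(v)-d^+_G(v)/k|<1 \quad\text{and}\quad |d^-_{G_i}(v)-d^-_G(v)/k|<1.$$ In particular, $|d_{G_i}(v)-d_G(v)/k|<1$ whenever $d^+_G(v)$ or $d^-_G(v)$ is divisible by $k$. Furthermore, such a decomposition can be chosen so that it additionally satisfies condition (i) below, and such a decomposition can also be chosen so that it additionally satisfies condition (ii) below: (i) $\big|\,|E(G_i)|-|E(G)|/k\,\big|<1$ for every $1\le i\le k$; (ii) for every vertex $u$ with $d^+_G(u)\equiv d^-_G(u) \pmod k$, we have $d_{G_i}(u)\equiv (d^+_G(u)-d^-_G(u))/k \pmod 2$ for every $1\le i\le k$.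
   Context: Graphs are finite and may have loops and multiple edges. A factor of $G$ is a spanning subgraph; "edge-decomposed into factors $G_1,\ldots,G_k$" means the edge set of $G$ is partitioned into the edge sets of the spanning subgraphs $G_1,\ldots,G_k$, each carrying the induced orientation. $d^+_G(v)$ and $d^-_G(v)$ denote out-degree and in-degree, and $d_G(v)=d^+_G(v)+d^-_G(v)$ is the degree (a loop at $v$ contributes $1$ to each of $d^+_G(v)$, $d^-_G(v)$). -}

module Defs where

open import Data.Nat using (ℕ; zero; suc; _+_; _*_; _<_)
open import Data.Fin using (Fin; zero; suc; _≟_)
open import Data.Bool using (Bool; true; false; _∧_)
open import Data.Product using (_×_)
open import Relation.Nullary.Decidable using (⌊_⌋)
open import Data.Integer as ℤ using (ℤ; +_; _-_)
open import Data.Integer.Divisibility as ℤD using ()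

-- A finite directed multigraph (loops and parallel edges allowed):
-- vertices Fin n, edges Fin m, each edge e goes from src e to tgt e.
record Digraph : Set where
  field
    n   : ℕ
    m   : ℕ
    src : Fin m → Fin n
    tgt : Fin m → Fin n
open Digraph public

count : ∀ {m} → (Fin m → Bool) → ℕ
count {zero}  P = 0
count {suc m} P = b2n (P zero) + count (λ e → P (suc e))
  where
  b2n : Bool → ℕ
  b2n true  = 1
  b2n false = 0

-- A spanning subgraph (factor) of G is given by its edge set S ⊆ E(G).
-- Out-/in-degree of v in the factor with edge set S (a loop counts 1 in each).
outdeg : (G : Digraph) → (Fin (m G) → Bool) → Fin (n G) → ℕ
outdeg G S v = count (λ e → S e ∧ ⌊ src G e ≟ v ⌋)

indeg : (G : Digraph) → (Fin (m G) → Bool) → Fin (n G) → ℕ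
indeg G S v = count (λ e → S e ∧ ⌊ tgt G e ≟ v ⌋)

deg : (G : Digraph) → (Fin (m G) → Bool) → Fin (n G) → ℕ
deg G S v = outdeg G S v + indeg G S v

size : (G : Digraph) → (Fin (m G) → Bool) → ℕ
size G S = count S

all : (G : Digraph) → Fin (m G) → Bool
all G e = true

-- An edge-decomposition into k factors G_1..G_k is a colouring col : E(G) → Fin k;
-- G_i has edge set { e | col e = i }.  (This is exactly a partition of E(G) into k
-- labelled, possibly empty, edge sets.)
Decomp : ℕ → Digraph → Set
Decomp k G = Fin (m G) → Fin k

part : {k : ℕ} (G : Digraph) → Decomp k G → Fin k → Fin (m G) → Bool
part G col i e = ⌊ col e ≟ i ⌋

-- |a - b/k| < 1  for naturals a, b and k ≥ 1, cleared of denominators: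
-- |k·a - b| < k, i.e.  k·a < b + k  and  b < k·a + k.
Close : ℕ → ℕ → ℕ → Set
Close k a b = (k * a < b + k) × (b < k * a + k)

Balanced : (k : ℕ) (G : Digraph) → Decomp k G → Set
Balanced k G col = ∀ (i : Fin k) (v : Fin (n G)) →
  Close k (outdeg G (part G col i) v) (outdeg G (all G) v) ×
  Close k (indeg G (part G col i) v) (indeg G (all G) v)

-- While two colour classes a and b differ by two or
-- more in one of the tracked counts (the out- and in-degree of each vertex, and either the number
-- of edges or, for (ii), the count out_c(v) + d⁻(v) - in_c(v)), recolour the a- and b-edges by a
-- balanced orientation of an auxiliary multigraph on out-ports, in-ports and a hub: such an
-- orientation exists for every multigraph (contract two edges at a common vertex into one), and
-- auxiliary edges at the odd-degree ports make the balance exact at all other ports, so every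
-- tracked count becomes nearly equal between a and b.  The other classes are unchanged and the sum
-- of squares of all tracked counts strictly decreases, so the process stops with every count
-- equitable, i.e. within one of its average d/k.  For (ii) the counts of a vertex u sum to
-- k(q + d⁻(u)), so each equals q + d⁻(u), which says out_c(u) - in_c(u) = q.

module Submission where

open import Defs
open import Data.Nat using (ℕ; _≤_; _*_; _+_)
open import Data.Nat.Divisibility using (_∣_)
open import Data.Fin using (Fin)
open import Data.Product using (Σ; _×_)
open import Data.Sum using (_⊎_)
open import Data.Integer as ℤ using (ℤ; +_; _-_)
open import Data.Integer.Divisibility as ℤD using ()
open import Relation.Binary.PropositionalEquality using (_≡_)

open import Data.Nat.Properties hiding (_≟_)
open import Algebra.Properties.CommutativeMonoid.Sum +-0-commutativeMonoid
  using (sum; sum-syntax; sum-cong-≗; sum-replicate-zero; sum-remove; ∑-distrib-+; ∑-comm)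
open import Algebra.Properties.CommutativeSemigroup +-commutativeSemigroup
  using () renaming (interchange to +-interchange)
open import Algebra.Properties.Semiring.Sum +-*-semiring using (*-distribˡ-sum)
open import Data.Bool using (Bool; true; false; not; _∧_; _∨_; _xor_; if_then_else_)
open import Data.Bool.Properties using (not-distribʳ-xor; ∧-identityʳ; ∧-zeroʳ)
open import Data.Empty using (⊥-elim)
open import Data.Fin using (zero; suc; punchIn; punchOut; _≟_; _↑ˡ_; _↑ʳ_; splitAt)
open import Data.Fin.Properties
  using (splitAt-↑ˡ; splitAt-↑ʳ; punchIn-injective; punchInᵢ≢i; punchIn-punchOut; any?; all?; ¬∀⟶∃¬)
open import Data.Integer using (-[1+_])
import Data.Integer.Properties as ZP
open import Data.Integer.Tactic.RingSolver using () renaming (solve-∀ to ℤsolve-∀)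
open import Data.List using (List; []; _∷_; _++_; map; allFin)
open import Data.List.Membership.Propositional using (_∈_; find)
open import Data.List.Membership.Propositional.Properties using (∈-++⁺ˡ; ∈-++⁺ʳ; ∈-map⁺; ∈-allFin)
open import Data.List.Relation.Unary.All as All using (All; []; _∷_)
open import Data.List.Relation.Unary.All.Properties using (¬All⇒Any¬; map⁺; tabulate⁺; ++⁺; ++⁻)
open import Data.List.Relation.Unary.Any using (here; there)
open import Data.Nat using (zero; suc; _<_; s≤s; z≤n; s≤s⁻¹)
open import Data.Nat.Divisibility using (divides)
open import Data.Nat.Induction using (<-wellFounded)
open import Data.Nat.Tactic.RingSolver using (solve-∀)
open import Data.Product using (_,_; proj₁; proj₂; ∃)
open import Data.Sum using (inj₁; inj₂; [_,_]′)
open import Data.Vec.Functional using (insertAt)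
import Data.Vec.Functional as Vector
open import Data.Vec.Functional.Properties using (insertAt-lookup; insertAt-punchIn)
open import Function using (_∘_)
open import Induction.WellFounded using (Acc; acc)
open import Relation.Binary.Definitions using (DecidableEquality; tri<; tri≈; tri>)
open import Relation.Binary.PropositionalEquality
  using (refl; sym; trans; cong; cong₂; subst; subst₂; _≢_; module ≡-Reasoning)
open import Relation.Nullary using (¬_; Dec; yes; no)
open import Relation.Nullary.Decidable using (⌊_⌋; _⊎-dec_; isYes≗does)
import Relation.Nullary.Decidable as Dec

toℕ : Bool → ℕ
toℕ true = 1
toℕ false = 0

⌊≟⌋-refl : ∀ {A : Set} (_≟_ : DecidableEquality A) x → ⌊ x ≟ x ⌋ ≡ true
⌊≟⌋-refl _≟_ x with x ≟ x
... | yes _ = refl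
... | no x≢x = ⊥-elim (x≢x refl)

⌊≟⌋-≢ : ∀ {A : Set} (_≟_ : DecidableEquality A) {x y} → x ≢ y → ⌊ x ≟ y ⌋ ≡ false
⌊≟⌋-≢ _≟_ {x} {y} x≢y with x ≟ y
... | yes x≡y = ⊥-elim (x≢y x≡y)
... | no _ = refl

count≡∑ : ∀ {m} (P : Fin m → Bool) → count P ≡ ∑[ e < m ] toℕ (P e)
count≡∑ {zero} P = refl
count≡∑ {suc m} P with P zero
... | true = cong suc (count≡∑ (P ∘ suc))
... | false = count≡∑ (P ∘ suc)

count-cong : ∀ {m} {P Q : Fin m → Bool} → (∀ e → P e ≡ Q e) → count P ≡ count Q
count-cong {P = P} {Q} P≗Q = trans (count≡∑ P) (trans (sum-cong-≗ (cong toℕ ∘ P≗Q)) (sym (count≡∑ Q)))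

count-+-cong : ∀ {m} {P Q P' Q' : Fin m → Bool} → (∀ e → toℕ (P e) + toℕ (Q e) ≡ toℕ (P' e) + toℕ (Q' e)) →
  count P + count Q ≡ count P' + count Q'
count-+-cong {m} {P} {Q} {P'} {Q'} pointwise = begin
  count P + count Q                     ≡⟨ cong₂ _+_ (count≡∑ P) (count≡∑ Q) ⟩
  sum (toℕ ∘ P) + sum (toℕ ∘ Q)         ≡⟨ ∑-distrib-+ (toℕ ∘ P) (toℕ ∘ Q) ⟨
  ∑[ e < m ] (toℕ (P e) + toℕ (Q e))    ≡⟨ sum-cong-≗ pointwise ⟩
  ∑[ e < m ] (toℕ (P' e) + toℕ (Q' e))  ≡⟨ ∑-distrib-+ (toℕ ∘ P') (toℕ ∘ Q') ⟩
  sum (toℕ ∘ P') + sum (toℕ ∘ Q')       ≡⟨ cong₂ _+_ (count≡∑ P') (count≡∑ Q') ⟨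
  count P' + count Q'                   ∎
  where open ≡-Reasoning

count-+ : ∀ {m} {P Q R : Fin m → Bool} → (∀ e → toℕ (P e) + toℕ (Q e) ≡ toℕ (R e)) → count P + count Q ≡ count R
count-+ {P = P} {Q} {R} pointwise = begin
  count P + count Q                     ≡⟨ cong₂ _+_ (count≡∑ P) (count≡∑ Q) ⟩
  sum (toℕ ∘ P) + sum (toℕ ∘ Q)         ≡⟨ ∑-distrib-+ (toℕ ∘ P) (toℕ ∘ Q) ⟨
  ∑[ e < _ ] (toℕ (P e) + toℕ (Q e))    ≡⟨ sum-cong-≗ pointwise ⟩
  sum (toℕ ∘ R)                         ≡⟨ count≡∑ R ⟨
  count R                               ∎
  where open ≡-Reasoning

count-none : ∀ m → count {m} (λ _ → false) ≡ 0
count-none zero = refl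
count-none (suc m) = count-none m

count-all : ∀ m → count {m} (λ _ → true) ≡ m
count-all zero = refl
count-all (suc m) = cong suc (count-all m)

∑-const : ∀ k x → ∑[ i < k ] x ≡ k * x
∑-const zero x = refl
∑-const (suc k) x = cong (_+_ x) (∑-const k x)

∑-suc : ∀ {k} (f : Fin k → ℕ) → ∑[ i < k ] suc (f i) ≡ k + sum f
∑-suc {k} f = trans (∑-distrib-+ (λ _ → 1) f) (cong (_+ sum f) (trans (∑-const k 1) (*-identityʳ k)))

∑-mono-≤ : ∀ {k} {f g : Fin k → ℕ} → (∀ i → f i ≤ g i) → sum f ≤ sum g
∑-mono-≤ {zero} f≤g = z≤n
∑-mono-≤ {suc k} f≤g = +-mono-≤ (f≤g zero) (∑-mono-≤ (f≤g ∘ suc))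

∑-mono-< : ∀ {k} {f g : Fin k → ℕ} (i : Fin k) → (∀ j → f j ≤ g j) → f i < g i → sum f < sum g
∑-mono-< {suc k} {f} {g} i f≤g fi<gi = begin-strict
  sum f                          ≡⟨ sum-remove f ⟩
  f i + sum (f ∘ punchIn i)      <⟨ +-mono-<-≤ fi<gi (∑-mono-≤ (f≤g ∘ punchIn i)) ⟩
  g i + sum (g ∘ punchIn i)      ≡⟨ sum-remove g ⟨
  sum g                          ∎
  where open ≤-Reasoning

∑-supported-at : ∀ {n} (v : Fin n) (f : Fin n → ℕ) → (∀ j → j ≢ v → f j ≡ 0) → sum f ≡ f v
∑-supported-at {suc n} v f off = begin
  sum f                      ≡⟨ sum-remove f ⟩
  f v + sum (f ∘ punchIn v)  ≡⟨ cong (_+_ (f v)) (trans (sum-cong-≗ (λ i → off (punchIn v i) (punchInᵢ≢i v i))) (sum-replicate-zero n)) ⟩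
  f v + 0                    ≡⟨ +-identityʳ (f v) ⟩
  f v                        ∎
  where open ≡-Reasoning

∑-↑ : ∀ m {n} (f : Fin (m + n) → ℕ) → sum f ≡ ∑[ i < m ] f (i ↑ˡ n) + ∑[ j < n ] f (m ↑ʳ j)
∑-↑ zero f = refl
∑-↑ (suc m) f = trans (cong (_+_ (f zero)) (∑-↑ m (f ∘ suc))) (sym (+-assoc (f zero) _ _))

∑-one-hot : ∀ {k} (d : Fin k) (g : Bool → ℕ) → ∑[ c < k ] g ⌊ d ≟ c ⌋ + g false ≡ g true + k * g false
∑-one-hot {suc k} d g = begin
  sum (λ c → g ⌊ d ≟ c ⌋) + g false
    ≡⟨ cong (_+ g false) (sum-remove (λ c → g ⌊ d ≟ c ⌋)) ⟩
  g ⌊ d ≟ d ⌋ + sum (λ i → g ⌊ d ≟ punchIn d i ⌋) + g false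
    ≡⟨ cong₂ (λ x y → g x + y + g false) (⌊≟⌋-refl _≟_ d) (sum-cong-≗ (λ i → cong g (⌊≟⌋-≢ _≟_ (punchInᵢ≢i d i ∘ sym)))) ⟩
  g true + ∑[ i < k ] g false + g false
    ≡⟨ cong (λ x → g true + x + g false) (∑-const k (g false)) ⟩
  g true + k * g false + g false
    ≡⟨ rearrange (g true) k (g false) ⟩
  g true + suc k * g false ∎
  where
  open ≡-Reasoning
  rearrange : ∀ x k y → x + k * y + y ≡ x + (y + k * y)
  rearrange = solve-∀

count-fibres : ∀ {m n} (f : Fin m → Fin n) (P : Fin m → Bool) → count P ≡ ∑[ v < n ] count (λ e → P e ∧ ⌊ f e ≟ v ⌋)
count-fibres {m} {n} f P = begin
  count P                                                  ≡⟨ count≡∑ P ⟩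
  ∑[ e < m ] toℕ (P e)                                     ≡⟨ sum-cong-≗ fibre ⟨
  ∑[ e < m ] ∑[ v < n ] toℕ (P e ∧ ⌊ f e ≟ v ⌋)            ≡⟨ ∑-comm (λ e v → toℕ (P e ∧ ⌊ f e ≟ v ⌋)) ⟩
  ∑[ v < n ] ∑[ e < m ] toℕ (P e ∧ ⌊ f e ≟ v ⌋)            ≡⟨ sum-cong-≗ (λ v → count≡∑ (λ e → P e ∧ ⌊ f e ≟ v ⌋)) ⟨
  ∑[ v < n ] count (λ e → P e ∧ ⌊ f e ≟ v ⌋)               ∎
  where
  open ≡-Reasoning
  fibre : ∀ e → ∑[ v < n ] toℕ (P e ∧ ⌊ f e ≟ v ⌋) ≡ toℕ (P e)
  fibre e with P e
  ... | false = sum-replicate-zero n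
  ... | true = trans (∑-supported-at (f e) _ (λ v v≢fe → cong toℕ (⌊≟⌋-≢ _≟_ (v≢fe ∘ sym)))) (cong toℕ (⌊≟⌋-refl _≟_ (f e)))

∑-agree-off-pair : ∀ {k} {a b : Fin k} → a ≢ b → (f g : Fin k → ℕ) → (∀ c → c ≢ a → c ≢ b → f c ≡ g c) →
  sum f + (g a + g b) ≡ sum g + (f a + f b)
∑-agree-off-pair {suc zero} {zero} {zero} a≢b f g agree = ⊥-elim (a≢b refl)
∑-agree-off-pair {suc (suc k)} {a} {b} a≢b f g agree = begin
  sum f + (g a + g b)                     ≡⟨ cong (_+ (g a + g b)) (split f) ⟩
  f a + (f b + rest f) + (g a + g b)      ≡⟨ cong (λ r → f a + (f b + r) + (g a + g b)) (sum-cong-≗ off) ⟩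
  f a + (f b + rest g) + (g a + g b)      ≡⟨ shuffle (f a) (f b) (g a) (g b) (rest g) ⟩
  g a + (g b + rest g) + (f a + f b)      ≡⟨ cong (_+ (f a + f b)) (split g) ⟨
  sum g + (f a + f b)                     ∎
  where
  open ≡-Reasoning
  b' = punchOut a≢b
  other : Fin k → Fin (suc (suc k))
  other i = punchIn a (punchIn b' i)
  rest : (Fin (suc (suc k)) → ℕ) → ℕ
  rest h = sum (h ∘ other)
  split : ∀ h → sum h ≡ h a + (h b + rest h)
  split h = trans (sum-remove h) (cong (_+_ (h a)) (trans (sum-remove (h ∘ punchIn a))
                  (cong (_+ rest h) (cong h (punchIn-punchOut a≢b)))))
  off : ∀ i → f (other i) ≡ g (other i)
  off i = agree (other i) (punchInᵢ≢i a (punchIn b' i))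
    (λ other≡b → punchInᵢ≢i b' i (punchIn-injective a _ _ (trans other≡b (sym (punchIn-punchOut a≢b)))))
  shuffle : ∀ fa fb ga gb r → fa + (fb + r) + (ga + gb) ≡ ga + (gb + r) + (fa + fb)
  shuffle = solve-∀

NearlyEqual : ℕ → ℕ → Set
NearlyEqual x y = x ≤ suc y × y ≤ suc x

NearlyEqual-sym : ∀ {x y} → NearlyEqual x y → NearlyEqual y x
NearlyEqual-sym (x≤1+y , y≤1+x) = y≤1+x , x≤1+y

NearlyEqual-reflexive : ∀ {x y} → x ≡ y → NearlyEqual x y
NearlyEqual-reflexive refl = n≤1+n _ , n≤1+n _

NearlyEqual-+ʳ : ∀ {x y} c → NearlyEqual x y → NearlyEqual (x + c) (y + c)
NearlyEqual-+ʳ c (x≤1+y , y≤1+x) = +-monoˡ-≤ c x≤1+y , +-monoˡ-≤ c y≤1+x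

NearlyEqual-+ˡ : ∀ c {x y} → NearlyEqual x y → NearlyEqual (c + x) (c + y)
NearlyEqual-+ˡ c {x} {y} (x≤1+y , y≤1+x) =
  subst (c + x ≤_) (+-suc c y) (+-monoʳ-≤ c x≤1+y) , subst (c + y ≤_) (+-suc c x) (+-monoʳ-≤ c y≤1+x)

NearlyEqual-cancelˡ : ∀ c {x y} → NearlyEqual (c + x) (c + y) → NearlyEqual x y
NearlyEqual-cancelˡ c {x} {y} (le₁ , le₂) =
  +-cancelˡ-≤ c x (suc y) (subst (c + x ≤_) (sym (+-suc c y)) le₁) ,
  +-cancelˡ-≤ c y (suc x) (subst (c + y ≤_) (sym (+-suc c x)) le₂)

NearlyEqual-offset : ∀ {x y p q} → x + p ≡ y + q → NearlyEqual p q → NearlyEqual x y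
NearlyEqual-offset {x} {y} {p} {q} x+p≡y+q (p≤1+q , q≤1+p) = bound x+p≡y+q q≤1+p , bound (sym x+p≡y+q) p≤1+q
  where
  bound : ∀ {x y p q} → x + p ≡ y + q → q ≤ suc p → x ≤ suc y
  bound {x} {y} {p} {q} x+p≡y+q q≤1+p = +-cancelʳ-≤ p x (suc y) (begin
    x + p        ≡⟨ x+p≡y+q ⟩
    y + q        ≤⟨ +-monoʳ-≤ y q≤1+p ⟩
    y + suc p    ≡⟨ +-suc y p ⟩
    suc y + p    ∎)
    where open ≤-Reasoning

NearlyEqual-bits : ∀ a b → NearlyEqual (toℕ a) (toℕ b)
NearlyEqual-bits false false = z≤n , z≤n
NearlyEqual-bits false true = z≤n , s≤s z≤n
NearlyEqual-bits true false = s≤s z≤n , z≤n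
NearlyEqual-bits true true = s≤s z≤n , s≤s z≤n

NearlyEqual-add-to-smaller : ∀ {A B} → NearlyEqual A B →
  NearlyEqual (A + toℕ ⌊ A ≤? B ⌋) (B + toℕ (not ⌊ A ≤? B ⌋))
NearlyEqual-add-to-smaller {A} {B} (A≤1+B , B≤1+A) with A ≤? B
... | yes A≤B rewrite +-identityʳ B | +-comm A 1 = s≤s A≤B , m≤n⇒m≤1+n B≤1+A
... | no A≰B rewrite +-identityʳ A | +-comm B 1 = m≤n⇒m≤1+n A≤1+B , m≤n⇒m≤1+n (≰⇒> A≰B)

odd≢even : ∀ x t → suc (x + x) ≢ t + t
odd≢even zero zero ()
odd≢even zero (suc t) 1≡t+1+t = m+1+n≢0 t (sym (suc-injective 1≡t+1+t))
odd≢even (suc x) (suc t) eq =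
  odd≢even x t (suc-injective (trans (sym (+-suc (suc x) x)) (trans (suc-injective eq) (+-suc t t))))

NearlyEqual-even⇒≡ : ∀ {x y t} → NearlyEqual x y → x + y ≡ t + t → x ≡ y
NearlyEqual-even⇒≡ {x} {y} {t} (x≤1+y , y≤1+x) x+y≡t+t with <-cmp x y
... | tri≈ _ x≡y _ = x≡y
... | tri< x<y _ _ = ⊥-elim (odd≢even x t (trans (sym (+-suc x x)) (subst (λ z → x + z ≡ t + t) (≤-antisym y≤1+x x<y) x+y≡t+t)))
... | tri> _ _ y<x = ⊥-elim (odd≢even y t (trans (sym (+-suc y y)) (subst (λ z → y + z ≡ t + t) (≤-antisym x≤1+y y<x) (trans (+-comm y x) x+y≡t+t))))

odd : ℕ → Bool
odd zero = false
odd (suc d) = not (odd d)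

+odd-even : ∀ d → ∃ λ t → d + toℕ (odd d) ≡ t + t
+odd-even zero = 0 , refl
+odd-even (suc d) with odd d | +odd-even d
... | true | t , d+1≡t+t = t , trans (sym (+-suc d 0)) d+1≡t+t
... | false | t , d+0≡t+t = suc t , cong suc (trans (+-suc d 0) (trans (cong suc d+0≡t+t) (sym (+-suc t t))))

cross-sums-equal : ∀ {oa ob ia ib α β} → oa + α ≡ ob + β → ia + α ≡ ib + β → oa + ib ≡ ob + ia
cross-sums-equal {oa} {ob} {ia} {ib} {α} {β} out≡ in≡ = +-cancelʳ-≡ (α + β) (oa + ib) (ob + ia) (begin
  oa + ib + (α + β)       ≡⟨ +-interchange oa ib α β ⟩
  oa + α + (ib + β)       ≡⟨ cong₂ _+_ out≡ (sym in≡) ⟩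
  ob + β + (ia + α)       ≡⟨ +-interchange ob β ia α ⟩
  ob + ia + (β + α)       ≡⟨ cong (_+_ (ob + ia)) (+-comm β α) ⟩
  ob + ia + (α + β)       ∎)
  where open ≡-Reasoning

NearlyEqual-difference : ∀ {x y o₁ o₂ i₁ i₂ I} → x + i₁ ≡ o₁ + I → y + i₂ ≡ o₂ + I →
  NearlyEqual (o₁ + i₂) (o₂ + i₁) → NearlyEqual x y
NearlyEqual-difference {x} {y} {o₁} {o₂} {i₁} {i₂} {I} hx hy balanced =
  NearlyEqual-cancelˡ (i₁ + i₂) (subst₂ NearlyEqual (sym e₁) (sym e₂) (NearlyEqual-+ʳ I balanced))
  where
  open ≡-Reasoning
  swap₁ : ∀ a b c → a + b + c ≡ c + a + b
  swap₁ = solve-∀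
  swap₂ : ∀ a b c → a + b + c ≡ a + c + b
  swap₂ = solve-∀
  swap₃ : ∀ a b c → a + b + c ≡ c + b + a
  swap₃ = solve-∀
  e₁ : i₁ + i₂ + x ≡ o₁ + i₂ + I
  e₁ = begin
    i₁ + i₂ + x   ≡⟨ swap₁ i₁ i₂ x ⟩
    x + i₁ + i₂   ≡⟨ cong (_+ i₂) hx ⟩
    o₁ + I + i₂   ≡⟨ swap₂ o₁ I i₂ ⟩
    o₁ + i₂ + I   ∎
  e₂ : i₁ + i₂ + y ≡ o₂ + i₁ + I
  e₂ = begin
    i₁ + i₂ + y   ≡⟨ swap₃ i₁ i₂ y ⟩
    y + i₂ + i₁   ≡⟨ cong (_+ i₁) hy ⟩
    o₂ + I + i₁   ≡⟨ swap₂ o₂ I i₁ ⟩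
    o₂ + i₁ + I   ∎

split-bit : ∀ p ρ → toℕ (p ∧ not ρ) + toℕ (p ∧ ρ) ≡ toℕ p
split-bit false ρ = refl
split-bit true false = refl
split-bit true true = refl

split-bit-∧ʳ : ∀ p ρ x → toℕ ((p ∧ not ρ) ∧ x) + toℕ ((p ∧ ρ) ∧ x) ≡ toℕ (p ∧ x)
split-bit-∧ʳ false ρ x = refl
split-bit-∧ʳ true false x = +-identityʳ (toℕ x)
split-bit-∧ʳ true true x = refl

split-bit-∧ˡ : ∀ L p ρ → toℕ (L ∧ (p ∧ not ρ)) + toℕ (L ∧ (p ∧ ρ)) ≡ toℕ (L ∧ p)
split-bit-∧ˡ false p ρ = refl
split-bit-∧ˡ true p ρ = split-bit p ρ

Equitable : ∀ {k} → (Fin k → ℕ) → Set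
Equitable f = ∀ a b → f a ≤ suc (f b)

equitable⇒close : ∀ {k} {f : Fin k → ℕ} → Equitable f → ∀ c → Close k (f c) (sum f)
equitable⇒close {k} {f} eq c = lower , upper
  where
  open ≤-Reasoning
  lower : k * f c < sum f + k
  lower = begin-strict
    k * f c               ≡⟨ ∑-const k (f c) ⟨
    ∑[ j < k ] f c        <⟨ ∑-mono-< c (eq c) (n<1+n (f c)) ⟩
    ∑[ j < k ] suc (f j)  ≡⟨ ∑-suc f ⟩
    k + sum f             ≡⟨ +-comm k (sum f) ⟩
    sum f + k             ∎
  upper : sum f < k * f c + k
  upper = begin-strict
    sum f                 <⟨ ∑-mono-< c (λ j → eq j c) (n<1+n (f c)) ⟩
    ∑[ j < k ] suc (f c)  ≡⟨ ∑-const k (suc (f c)) ⟩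
    k * suc (f c)         ≡⟨ *-suc k (f c) ⟩
    k + k * f c           ≡⟨ +-comm k (k * f c) ⟩
    k * f c + k           ∎

close-multiple⇒≡ : ∀ {k x t} → Close k x (k * t) → x ≡ t
close-multiple⇒≡ {k} {x} {t} (kx<kt+k , kt<kx+k) =
  ≤-antisym (s≤s⁻¹ (*-cancelˡ-< k x (suc t) (subst (k * x <_) (k*t+k≡k*[1+t] t) kx<kt+k)))
            (s≤s⁻¹ (*-cancelˡ-< k t (suc x) (subst (k * t <_) (k*t+k≡k*[1+t] x) kt<kx+k)))
  where
  k*t+k≡k*[1+t] : ∀ t → k * t + k ≡ k * suc t
  k*t+k≡k*[1+t] t = trans (+-comm (k * t) k) (sym (*-suc k t))

close-+-multiple : ∀ {k x y X Y} → k ∣ X → Close k x X → Close k y Y → Close k (x + y) (X + Y)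
close-+-multiple {k} {x} {y} {X} {Y} (divides q X≡qk) x≈X (ky<Y+k , Y<ky+k) = lower , upper
  where
  X≡kx : X ≡ k * x
  X≡kx = trans X≡qk (trans (*-comm q k) (cong (k *_) (sym (close-multiple⇒≡ {k} (subst (Close k x) (trans X≡qk (*-comm q k)) x≈X)))))
  open ≤-Reasoning
  lower : k * (x + y) < X + Y + k
  lower = begin-strict
    k * (x + y)        ≡⟨ *-distribˡ-+ k x y ⟩
    k * x + k * y      <⟨ +-monoʳ-< (k * x) ky<Y+k ⟩
    k * x + (Y + k)    ≡⟨ cong (λ z → z + (Y + k)) X≡kx ⟨
    X + (Y + k)        ≡⟨ +-assoc X Y k ⟨
    X + Y + k          ∎
  upper : X + Y < k * (x + y) + k
  upper = begin-strict
    X + Y              ≡⟨ cong (_+ Y) X≡kx ⟩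
    k * x + Y          <⟨ +-monoʳ-< (k * x) Y<ky+k ⟩
    k * x + (k * y + k) ≡⟨ +-assoc (k * x) (k * y) k ⟨
    k * x + k * y + k  ≡⟨ cong (_+ k) (*-distribˡ-+ k x y) ⟨
    k * (x + y) + k    ∎

close-+ : ∀ {k x y X Y} → (k ∣ X) ⊎ (k ∣ Y) → Close k x X → Close k y Y → Close k (x + y) (X + Y)
close-+ (inj₁ k∣X) x≈X y≈Y = close-+-multiple k∣X x≈X y≈Y
close-+ {k} {x} {y} {X} {Y} (inj₂ k∣Y) x≈X y≈Y =
  subst₂ (Close k) (+-comm y x) (+-comm Y X) (close-+-multiple k∣Y y≈Y x≈X)

-- Balancing a pair lowers its sum of squares

square-sum : ℕ → ℕ → ℕ
square-sum a b = a * a + b * b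

-- Writing x' = y + t, y' = y + t + δ and x = y + 2t + δ, the square sums differ by exactly
-- 2t(t + δ), which is positive once x ≥ y + 2.
square-sum-spread : ∀ y t δ → δ ≤ 1 →
  square-sum (y + t) (y + t + δ) ≤ square-sum (y + (t + (t + δ))) y ×
  (2 + y ≤ y + (t + (t + δ)) → square-sum (y + t) (y + t + δ) < square-sum (y + (t + (t + δ))) y)
square-sum-spread y t δ δ≤1 =
  subst (square-sum (y + t) (y + t + δ) ≤_) (spread y t δ) (m≤m+n _ (2 * (t * (t + δ)))) , strict t
  where
  spread : ∀ y t δ → (y + t) * (y + t) + (y + t + δ) * (y + t + δ) + 2 * (t * (t + δ))
                   ≡ (y + (t + (t + δ))) * (y + (t + (t + δ))) + y * y
  spread = solve-∀
  strict : ∀ t → 2 + y ≤ y + (t + (t + δ)) → square-sum (y + t) (y + t + δ) < square-sum (y + (t + (t + δ))) y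
  strict zero 2+y≤y+δ = ⊥-elim (<⇒≱ (+-monoʳ-< y (s≤s δ≤1)) (subst (_≤ y + δ) (+-comm 2 y) 2+y≤y+δ))
  strict (suc t) _ = subst (square-sum (y + suc t) (y + suc t + δ) <_) (spread y (suc t) δ) (m<m+n _ {2 * (suc t * (suc t + δ))} (s≤s z≤n))

min-≤-balanced-min : ∀ {x y x' y'} → y ≤ x → y' ≤ suc x' → x' + y' ≡ x + y → y ≤ x'
min-≤-balanced-min {x} {y} {x'} {y'} y≤x y'≤1+x' eq = ≮⇒≥ λ x'<y → <-irrefl refl (begin-strict
  x + y              ≡⟨ eq ⟨
  x' + y'            ≤⟨ +-monoʳ-≤ x' y'≤1+x' ⟩
  x' + suc x'        <⟨ +-monoˡ-< (suc x') (n<1+n x') ⟩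
  suc x' + suc x'    ≤⟨ +-mono-≤ x'<y x'<y ⟩
  y + y              ≤⟨ +-monoˡ-≤ y y≤x ⟩
  x + y              ∎)
  where open ≤-Reasoning

larger-part-≡ : ∀ {x y t δ} → y + t + (y + t + δ) ≡ x + y → x ≡ y + (t + (t + δ))
larger-part-≡ {x} {y} {t} {δ} eq = +-cancelʳ-≡ y x (y + (t + (t + δ))) (trans (sym eq) (rearrange y t δ))
  where
  rearrange : ∀ y t δ → y + t + (y + t + δ) ≡ y + (t + (t + δ)) + y
  rearrange = solve-∀

squares-decrease-ordered : ∀ {x y x' y'} → y ≤ x → x' ≤ y' → y' ≤ suc x' → x' + y' ≡ x + y →
  square-sum x' y' ≤ square-sum x y × (2 + y ≤ x → square-sum x' y' < square-sum x y)
squares-decrease-ordered {x} {y} {x'} {y'} y≤x x'≤y' y'≤1+x' eq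
  with δ , refl ← m≤n⇒∃[o]m+o≡n x'≤y'
  with t , refl ← m≤n⇒∃[o]m+o≡n (min-≤-balanced-min y≤x y'≤1+x' eq)
  with refl ← larger-part-≡ {x} {y} {t} {δ} eq =
  square-sum-spread y t δ (+-cancelˡ-≤ (y + t) δ 1 (subst (y + t + δ ≤_) (+-comm 1 (y + t)) y'≤1+x'))

squares-decrease : ∀ {x y x' y'} → x' + y' ≡ x + y → NearlyEqual x' y' →
  square-sum x' y' ≤ square-sum x y × (2 + y ≤ x → square-sum x' y' < square-sum x y)
squares-decrease {x} {y} {x'} {y'} eq (x'≤1+y' , y'≤1+x') with ≤-total x' y' | ≤-total y x
... | inj₁ x'≤y' | inj₁ y≤x = squares-decrease-ordered y≤x x'≤y' y'≤1+x' eq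
... | inj₂ y'≤x' | inj₁ y≤x =
  subst (λ s → s ≤ square-sum x y × (2 + y ≤ x → s < square-sum x y)) (+-comm (y' * y') (x' * x'))
    (squares-decrease-ordered y≤x y'≤x' x'≤1+y' (trans (+-comm y' x') eq))
... | inj₁ x'≤y' | inj₂ x≤y =
  subst (square-sum x' y' ≤_) (+-comm (y * y) (x * x)) (proj₁ (squares-decrease-ordered x≤y x'≤y' y'≤1+x' (trans eq (+-comm x y)))) ,
  λ 2+y≤x → ⊥-elim (<-irrefl refl (≤-trans (s≤s (m≤n+m y 1)) (≤-trans 2+y≤x x≤y)))
... | inj₂ y'≤x' | inj₂ x≤y =
  subst₂ _≤_ (+-comm (y' * y') (x' * x')) (+-comm (y * y) (x * x))
    (proj₁ (squares-decrease-ordered x≤y y'≤x' x'≤1+y' (trans (+-comm y' x') (trans eq (+-comm x y))))) ,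
  λ 2+y≤x → ⊥-elim (<-irrefl refl (≤-trans (s≤s (m≤n+m y 1)) (≤-trans 2+y≤x x≤y)))

-- Balanced orientations of multigraphs

orient : ∀ {V : Set} → Bool → V × V → V × V
orient false p = p
orient true (x , y) = (y , x)

endpoint : ∀ {V : Set} → Bool → V × V → V
endpoint false (x , y) = x
endpoint true (x , y) = y

endpoint-orient : ∀ {V : Set} s ρ (p : V × V) → endpoint s (orient ρ p) ≡ endpoint (s xor ρ) p
endpoint-orient false false p = refl
endpoint-orient false true p = refl
endpoint-orient true false p = refl
endpoint-orient true true p = refl

orient-xor : ∀ {V : Set} ρ φ (p : V × V) → orient (ρ xor φ) p ≡ orient ρ (orient φ p)
orient-xor false φ p = refl
orient-xor true false p = refl
orient-xor true true (x , y) = refl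

module Orientation {V : Set} (_≟_ : DecidableEquality V) where

  hits : V → V → ℕ
  hits u v = toℕ ⌊ u ≟ v ⌋

  hits-≢ : ∀ {u v} → u ≢ v → hits u v ≡ 0
  hits-≢ u≢v = cong toℕ (⌊≟⌋-≢ _≟_ u≢v)

  hits-self : ∀ v → hits v v ≡ 1
  hits-self v = cong toℕ (⌊≟⌋-refl _≟_ v)

  hits-loop : ∀ s ρ x v → hits (endpoint s (orient ρ (x , x))) v ≡ hits x v
  hits-loop false false x v = refl
  hits-loop false true x v = refl
  hits-loop true false x v = refl
  hits-loop true true x v = refl

  endcount : ∀ {M} → Bool → (Fin M → V × V) → V → ℕ
  endcount s E v = ∑[ i < _ ] hits (endpoint s (E i)) v

  outdegree indegree : ∀ {M} → (Fin M → V × V) → V → ℕ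
  outdegree = endcount false
  indegree = endcount true

  reorient : ∀ {M} → (Fin M → Bool) → (Fin M → V × V) → Fin M → V × V
  reorient r E i = orient (r i) (E i)

  IsBalanced : ∀ {M} → (Fin M → V × V) → Set
  IsBalanced E = ∀ v → NearlyEqual (outdegree E v) (indegree E v)

  Touches : V → V × V → Set
  Touches x (u , w) = x ≡ u ⊎ x ≡ w

  touches? : ∀ x p → Dec (Touches x p)
  touches? x (u , w) = (x ≟ u) ⊎-dec (x ≟ w)

  -- Oriented y → x → z (σ = false) or z → x → y (σ = true), the edges xy and xz have the ends of
  -- the contracted edge yz plus one tail and one head at x.
  merge-ends : ∀ σ x y z v → hits (endpoint (not σ) (x , y)) v + hits (endpoint σ (x , z)) v
                          ≡ hits (endpoint σ (y , z)) v + hits x v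
  merge-ends false x y z v = refl
  merge-ends true x y z v = +-comm (hits x v) (hits z v)

  module Merge {M} (E : Fin (suc (suc M)) → V × V) (j : Fin (suc M)) (φ : Bool) (z : V)
               (f≡xz : orient φ (E (suc j)) ≡ (proj₁ (E zero) , z)) where

    x y : V
    x = proj₁ (E zero)
    y = proj₂ (E zero)

    merged : Fin (suc M) → V × V
    merged zero = (y , z)
    merged (suc i) = E (suc (punchIn j i))

    unmerge : (Fin (suc M) → Bool) → Fin (suc (suc M)) → Bool
    unmerge r zero = not (r zero)
    unmerge r (suc i) = insertAt (r ∘ suc) j (r zero xor φ) i

    endcount-unmerge : ∀ r s v → endcount s (reorient (unmerge r) E) v ≡ endcount s (reorient r merged) v + hits x v
    endcount-unmerge r s v = begin
      hits (endpoint s (orient (not ρ) (x , y))) v + sum T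
        ≡⟨ cong₂ _+_ (cong (λ w → hits w v) e-end) (sum-remove T) ⟩
      hits (endpoint (not σ) (x , y)) v + (T j + sum (T ∘ punchIn j))
        ≡⟨ cong₂ (λ a b → hits (endpoint (not σ) (x , y)) v + (a + b)) f-end (sum-cong-≗ rest) ⟩
      hits (endpoint (not σ) (x , y)) v + (hits (endpoint σ (x , z)) v + R)
        ≡⟨ +-assoc (hits (endpoint (not σ) (x , y)) v) _ R ⟨
      hits (endpoint (not σ) (x , y)) v + hits (endpoint σ (x , z)) v + R
        ≡⟨ cong (_+ R) (merge-ends σ x y z v) ⟩
      hits (endpoint σ (y , z)) v + hits x v + R
        ≡⟨ +-assoc (hits (endpoint σ (y , z)) v) (hits x v) R ⟩
      hits (endpoint σ (y , z)) v + (hits x v + R)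
        ≡⟨ cong₂ _+_ (cong (λ w → hits w v) (sym (endpoint-orient s ρ (y , z)))) (+-comm (hits x v) R) ⟩
      hits (endpoint s (orient ρ (y , z))) v + (R + hits x v)
        ≡⟨ +-assoc (hits (endpoint s (orient ρ (y , z))) v) R (hits x v) ⟨
      endcount s (reorient r merged) v + hits x v ∎
      where
      open ≡-Reasoning
      ρ = r zero
      σ = s xor ρ
      T : Fin (suc M) → ℕ
      T i = hits (endpoint s (orient (unmerge r (suc i)) (E (suc i)))) v
      R : ℕ
      R = ∑[ i < M ] hits (endpoint s (orient (r (suc i)) (merged (suc i)))) v
      e-end : endpoint s (orient (not ρ) (x , y)) ≡ endpoint (not σ) (x , y)
      e-end = trans (endpoint-orient s (not ρ) (x , y)) (cong (λ b → endpoint b (x , y)) (sym (not-distribʳ-xor s ρ)))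
      f-end : T j ≡ hits (endpoint σ (x , z)) v
      f-end = cong (λ w → hits w v) (begin
        endpoint s (orient (insertAt (r ∘ suc) j (ρ xor φ) j) (E (suc j)))
          ≡⟨ cong (λ b → endpoint s (orient b (E (suc j)))) (insertAt-lookup (r ∘ suc) j (ρ xor φ)) ⟩
        endpoint s (orient (ρ xor φ) (E (suc j)))
          ≡⟨ cong (endpoint s) (trans (orient-xor ρ φ (E (suc j))) (cong (orient ρ) f≡xz)) ⟩
        endpoint s (orient ρ (x , z))
          ≡⟨ endpoint-orient s ρ (x , z) ⟩
        endpoint σ (x , z) ∎)
      rest : ∀ i → T (punchIn j i) ≡ hits (endpoint s (orient (r (suc i)) (merged (suc i)))) v
      rest i = cong (λ b → hits (endpoint s (orient b (E (suc (punchIn j i))))) v) (insertAt-punchIn (r ∘ suc) j (ρ xor φ) i)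

  touching-orientation : ∀ {x} p → Touches x p → Σ Bool λ φ → Σ V λ z → orient φ p ≡ (x , z)
  touching-orientation (u , w) (inj₁ refl) = false , w , refl
  touching-orientation (u , w) (inj₂ refl) = true , u , refl

  endpoint-≢ : ∀ {x} σ p → ¬ Touches x p → endpoint σ p ≢ x
  endpoint-≢ false (u , w) ¬touch u≡x = ¬touch (inj₁ (sym u≡x))
  endpoint-≢ true (u , w) ¬touch w≡x = ¬touch (inj₂ (sym w≡x))

  hits-other-end : ∀ {x y} ρ → x ≢ y → hits (endpoint ρ (x , y)) y ≡ toℕ ρ
  hits-other-end false x≢y = hits-≢ x≢y
  hits-other-end {y = y} true x≢y = hits-self y

  hits-neither-end : ∀ {x y v} σ → x ≢ v → y ≢ v → hits (endpoint σ (x , y)) v ≡ 0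
  hits-neither-end false x≢v y≢v = hits-≢ x≢v
  hits-neither-end true x≢v y≢v = hits-≢ y≢v

  module Pendant {M} (E : Fin (suc M) → V × V) (isolated : ∀ j → ¬ Touches (proj₁ (E zero)) (E (suc j))) where

    x y : V
    x = proj₁ (E zero)
    y = proj₂ (E zero)

    endcount-∷ : ∀ ρ r s v → endcount s (reorient (ρ Vector.∷ r) E) v ≡ hits (endpoint (s xor ρ) (x , y)) v + endcount s (reorient r (E ∘ suc)) v
    endcount-∷ ρ r s v = cong (λ w → hits w v + endcount s (reorient r (E ∘ suc)) v) (endpoint-orient s ρ (E zero))

    endcount-rest-at-x : ∀ r s → endcount s (reorient r (E ∘ suc)) x ≡ 0
    endcount-rest-at-x r s = trans (sum-cong-≗ none) (sum-replicate-zero M)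
      where
      none : ∀ i → hits (endpoint s (orient (r i) (E (suc i)))) x ≡ 0
      none i = trans (cong (λ w → hits w x) (endpoint-orient s (r i) (E (suc i))))
                     (hits-≢ (endpoint-≢ (s xor r i) (E (suc i)) (isolated i)))

    leaves-y : (Fin M → Bool) → Bool
    leaves-y r = ⌊ outdegree (reorient r (E ∘ suc)) y ≤? indegree (reorient r (E ∘ suc)) y ⌋

    extend-balanced : ∀ r → IsBalanced (reorient r (E ∘ suc)) → IsBalanced (reorient (leaves-y r Vector.∷ r) E)
    extend-balanced r balanced v
      rewrite endcount-∷ (leaves-y r) r false v | endcount-∷ (leaves-y r) r true v with x ≟ v
    ... | yes refl rewrite endcount-rest-at-x r false | endcount-rest-at-x r true
                         | +-identityʳ (hits (endpoint (leaves-y r) (x , y)) x)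
                         | +-identityʳ (hits (endpoint (not (leaves-y r)) (x , y)) x) =
      NearlyEqual-bits _ _
    ... | no x≢v with y ≟ v
    ...   | no y≢v rewrite hits-neither-end (leaves-y r) x≢v y≢v | hits-neither-end (not (leaves-y r)) x≢v y≢v =
      balanced v
    ...   | yes refl rewrite hits-other-end (leaves-y r) x≢v | hits-other-end (not (leaves-y r)) x≢v =
      subst₂ NearlyEqual (+-comm _ (toℕ (leaves-y r))) (+-comm _ (toℕ (not (leaves-y r))))
        (NearlyEqual-add-to-smaller (balanced y))

  Orientable : ∀ {M} → (Fin M → V × V) → Set
  Orientable {M} E = Σ (Fin M → Bool) λ r → IsBalanced (reorient r E)

  merge-orientable : ∀ {M} (E : Fin (suc (suc M)) → V × V) (j : Fin (suc M)) (φ : Bool) (z : V)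
    (f≡xz : orient φ (E (suc j)) ≡ (proj₁ (E zero) , z)) → Orientable (Merge.merged E j φ z f≡xz) → Orientable E
  merge-orientable E j φ z f≡xz (r , balanced) = unmerge r , λ v →
    subst₂ NearlyEqual (sym (endcount-unmerge r false v)) (sym (endcount-unmerge r true v))
      (NearlyEqual-+ʳ (hits x v) (balanced v))
    where open Merge E j φ z f≡xz

  pendant-orientable : ∀ {M} (E : Fin (suc M) → V × V) (isolated : ∀ j → ¬ Touches (proj₁ (E zero)) (E (suc j))) →
    Orientable (E ∘ suc) → Orientable E
  pendant-orientable E isolated (r , balanced) = leaves-y r Vector.∷ r , extend-balanced r balanced
    where open Pendant E isolated

  -- If the first edge xy meets another edge at x, contract the two into one; otherwise xy is
  -- pendant at x and is oriented last, so as to balance y.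
  one-edge-fewer : ∀ {M} (E : Fin (suc (suc M)) → V × V) →
    Σ (Fin (suc M) → V × V) λ E' → Orientable E' → Orientable E
  one-edge-fewer E with any? (λ j → touches? (proj₁ (E zero)) (E (suc j)))
  ... | no untouched = E ∘ suc , pendant-orientable E (λ j touch → untouched (j , touch))
  ... | yes (j , touch) with touching-orientation (E (suc j)) touch
  ...   | φ , z , f≡xz = Merge.merged E j φ z f≡xz , merge-orientable E j φ z f≡xz

  balanced-orientation : ∀ {M} (E : Fin M → V × V) → Orientable E
  balanced-orientation {zero} E = (λ ()) , λ v → z≤n , z≤n
  balanced-orientation {suc zero} E = pendant-orientable E (λ ()) (balanced-orientation (E ∘ suc))
  balanced-orientation {suc (suc M)} E = proj₂ (one-edge-fewer E) (balanced-orientation (proj₁ (one-edge-fewer E)))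

-- Equitable colourings by repeatedly rebalancing two colour classes

-- h e b tells whether edge e is counted, b being whether e lies in the colour class at hand.
Counter : ℕ → Set
Counter m = Fin m → Bool → Bool

tally : ∀ {m k} → Counter m → (Fin m → Fin k) → Fin k → ℕ
tally h col c = count (λ e → h e ⌊ col e ≟ c ⌋)

∑-tally : ∀ {m k} (h : Counter m) (col : Fin m → Fin k) →
  sum (tally h col) + count (λ e → h e false) ≡ count (λ e → h e true) + k * count (λ e → h e false)
∑-tally {m} {k} h col = begin
  sum (tally h col) + count (λ e → h e false)
    ≡⟨ cong₂ _+_ (sum-cong-≗ (λ c → count≡∑ (λ e → h e ⌊ col e ≟ c ⌋))) (count≡∑ (λ e → h e false)) ⟩
  ∑[ c < k ] ∑[ e < m ] I e c + sum F
    ≡⟨ cong (_+ sum F) (∑-comm (λ c e → I e c)) ⟩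
  ∑[ e < m ] ∑[ c < k ] I e c + sum F
    ≡⟨ ∑-distrib-+ (λ e → ∑[ c < k ] I e c) F ⟨
  ∑[ e < m ] (∑[ c < k ] I e c + F e)
    ≡⟨ sum-cong-≗ (λ e → ∑-one-hot (col e) (toℕ ∘ h e)) ⟩
  ∑[ e < m ] (T e + k * F e)
    ≡⟨ ∑-distrib-+ T (λ e → k * F e) ⟩
  sum T + ∑[ e < m ] (k * F e)
    ≡⟨ cong₂ _+_ (count≡∑ (λ e → h e true)) (trans (cong (k *_) (count≡∑ (λ e → h e false))) (*-distribˡ-sum k F)) ⟨
  count (λ e → h e true) + k * count (λ e → h e false) ∎
  where
  open ≡-Reasoning
  I : Fin m → Fin k → ℕ
  I e c = toℕ (h e ⌊ col e ≟ c ⌋)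
  T F : Fin m → ℕ
  T e = toℕ (h e true)
  F e = toℕ (h e false)

class-close : ∀ {m k} (h : Counter m) {col : Fin m → Fin k} → (∀ e → h e false ≡ false) →
  Equitable (tally h col) → ∀ c → Close k (tally h col c) (count (λ e → h e true))
class-close {m} {k} h {col} ignores-outside equitable c =
  subst (Close k (tally h col c)) total (equitable⇒close equitable c)
  where
  open ≡-Reasoning
  none : count (λ e → h e false) ≡ 0
  none = trans (count-cong ignores-outside) (count-none m)
  total : sum (tally h col) ≡ count (λ e → h e true)
  total = begin
    sum (tally h col)                                     ≡⟨ +-identityʳ _ ⟨
    sum (tally h col) + 0                                 ≡⟨ cong (_+_ (sum (tally h col))) none ⟨
    sum (tally h col) + count (λ e → h e false)           ≡⟨ ∑-tally h col ⟩
    count (λ e → h e true) + k * count (λ e → h e false)  ≡⟨ cong (λ z → count (λ e → h e true) + k * z) none ⟩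
    count (λ e → h e true) + k * 0                        ≡⟨ cong (_+_ (count (λ e → h e true))) (*-zeroʳ k) ⟩
    count (λ e → h e true) + 0                            ≡⟨ +-identityʳ _ ⟩
    count (λ e → h e true)                                ∎

squares : ∀ {m k} → Counter m → (Fin m → Fin k) → ℕ
squares h col = ∑[ c < _ ] (tally h col c * tally h col c)

inPair : ∀ {m k} → (Fin m → Fin k) → Fin k → Fin k → Fin m → Bool
inPair col a b e = ⌊ col e ≟ a ⌋ ∨ ⌊ col e ≟ b ⌋

recolour : ∀ {m k} → (Fin m → Fin k) → Fin k → Fin k → (Fin m → Bool) → Fin m → Fin k
recolour col a b r e = if inPair col a b e then (if r e then b else a) else col e

exchange-bits : ∀ (g : Bool → ℕ) α β ρ → α ∧ β ≡ false →
  g ((α ∨ β) ∧ not ρ) + g ((α ∨ β) ∧ ρ) ≡ g α + g β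
exchange-bits g true true ρ ()
exchange-bits g true false false _ = refl
exchange-bits g true false true _ = +-comm (g false) (g true)
exchange-bits g false true false _ = +-comm (g true) (g false)
exchange-bits g false true true _ = refl
exchange-bits g false false ρ _ = refl

module Recolouring {m k} (col : Fin m → Fin k) {a b : Fin k} (a≢b : a ≢ b) (r : Fin m → Bool) where

  col' : Fin m → Fin k
  col' = recolour col a b r

  recoloured-a : ∀ e → ⌊ col' e ≟ a ⌋ ≡ inPair col a b e ∧ not (r e)
  recoloured-a e with col e ≟ a | col e ≟ b | r e
  ... | yes _ | _ | true = ⌊≟⌋-≢ _≟_ (a≢b ∘ sym)
  ... | yes _ | _ | false = ⌊≟⌋-refl _≟_ a
  ... | no _ | yes _ | true = ⌊≟⌋-≢ _≟_ (a≢b ∘ sym)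
  ... | no _ | yes _ | false = ⌊≟⌋-refl _≟_ a
  ... | no col≢a | no _ | _ = ⌊≟⌋-≢ _≟_ col≢a

  recoloured-b : ∀ e → ⌊ col' e ≟ b ⌋ ≡ inPair col a b e ∧ r e
  recoloured-b e with col e ≟ a | col e ≟ b | r e
  ... | yes _ | _ | true = ⌊≟⌋-refl _≟_ b
  ... | yes _ | _ | false = ⌊≟⌋-≢ _≟_ a≢b
  ... | no _ | yes _ | true = ⌊≟⌋-refl _≟_ b
  ... | no _ | yes _ | false = ⌊≟⌋-≢ _≟_ a≢b
  ... | no _ | no col≢b | _ = ⌊≟⌋-≢ _≟_ col≢b

  recoloured-other : ∀ {c} → c ≢ a → c ≢ b → ∀ e → ⌊ col' e ≟ c ⌋ ≡ ⌊ col e ≟ c ⌋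
  recoloured-other {c} c≢a c≢b e with col e ≟ a | col e ≟ b | r e
  ... | yes col≡a | _ | true = trans (⌊≟⌋-≢ _≟_ (c≢b ∘ sym)) (sym (⌊≟⌋-≢ _≟_ λ col≡c → c≢a (trans (sym col≡c) col≡a)))
  ... | yes col≡a | _ | false = cong (λ d → ⌊ d ≟ c ⌋) (sym col≡a)
  ... | no _ | yes col≡b | true = cong (λ d → ⌊ d ≟ c ⌋) (sym col≡b)
  ... | no _ | yes col≡b | false = trans (⌊≟⌋-≢ _≟_ (c≢a ∘ sym)) (sym (⌊≟⌋-≢ _≟_ λ col≡c → c≢b (trans (sym col≡c) col≡b)))
  ... | no _ | no _ | _ = refl

  pair-disjoint : ∀ e → ⌊ col e ≟ a ⌋ ∧ ⌊ col e ≟ b ⌋ ≡ false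
  pair-disjoint e with col e ≟ a
  ... | yes refl = ⌊≟⌋-≢ _≟_ a≢b
  ... | no _ = refl

  tally-other : ∀ h {c} → c ≢ a → c ≢ b → tally h col' c ≡ tally h col c
  tally-other h c≢a c≢b = count-cong (λ e → cong (h e) (recoloured-other c≢a c≢b e))

  tally-pair : ∀ h → tally h col' a + tally h col' b ≡ tally h col a + tally h col b
  tally-pair h = count-+-cong exchange
    where
    exchange : ∀ e → toℕ (h e ⌊ col' e ≟ a ⌋) + toℕ (h e ⌊ col' e ≟ b ⌋) ≡ toℕ (h e ⌊ col e ≟ a ⌋) + toℕ (h e ⌊ col e ≟ b ⌋)
    exchange e rewrite recoloured-a e | recoloured-b e =
      exchange-bits (toℕ ∘ h e) ⌊ col e ≟ a ⌋ ⌊ col e ≟ b ⌋ (r e) (pair-disjoint e)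

  squares-recolour : ∀ h → NearlyEqual (tally h col' a) (tally h col' b) →
    squares h col' ≤ squares h col × (2 + tally h col b ≤ tally h col a → squares h col' < squares h col)
  squares-recolour h balanced = +-cancelʳ-≤ (before a + before b) (sum after) (sum before) (shift (proj₁ pair)) ,
    λ gap → +-cancelʳ-< (before a + before b) (sum after) (sum before) (shift-< (proj₂ pair gap))
    where
    after before : Fin k → ℕ
    after c = tally h col' c * tally h col' c
    before c = tally h col c * tally h col c
    pair = squares-decrease (tally-pair h) balanced
    agree : ∀ c → c ≢ a → c ≢ b → after c ≡ before c
    agree c c≢a c≢b = cong (λ t → t * t) (tally-other h c≢a c≢b)
    exchange : sum after + (before a + before b) ≡ sum before + (after a + after b)
    exchange = ∑-agree-off-pair a≢b after before agree
    shift : after a + after b ≤ before a + before b → sum after + (before a + before b) ≤ sum before + (before a + before b)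
    shift le = subst (_≤ sum before + (before a + before b)) (sym exchange) (+-monoʳ-≤ (sum before) le)
    shift-< : after a + after b < before a + before b → sum after + (before a + before b) < sum before + (before a + before b)
    shift-< lt = subst (_< sum before + (before a + before b)) (sym exchange) (+-monoʳ-< (sum before) lt)

Rebalancer : ∀ {m} k → List (Counter m) → Set
Rebalancer {m} k hs = ∀ (col : Fin m → Fin k) {a b} → a ≢ b → Σ (Fin m → Bool) λ r →
  All (λ h → NearlyEqual (tally h (recolour col a b r) a) (tally h (recolour col a b r) b)) hs

potential : ∀ {m k} → List (Counter m) → (Fin m → Fin k) → ℕ
potential [] col = 0
potential (h ∷ hs) col = squares h col + potential hs col

potential-mono : ∀ {m k} {hs : List (Counter m)} {col col' : Fin m → Fin k} →
  All (λ h → squares h col' ≤ squares h col) hs → potential hs col' ≤ potential hs col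
potential-mono [] = z≤n
potential-mono (le ∷ les) = +-mono-≤ le (potential-mono les)

potential-decrease : ∀ {m k} {hs : List (Counter m)} {col col' : Fin m → Fin k} {h} →
  All (λ h → squares h col' ≤ squares h col) hs → h ∈ hs → squares h col' < squares h col →
  potential hs col' < potential hs col
potential-decrease (_ ∷ les) (here refl) lt = +-mono-<-≤ lt (potential-mono les)
potential-decrease (le ∷ les) (there h∈hs) lt = +-mono-≤-< le (potential-decrease les h∈hs lt)

equitable? : ∀ {k} (f : Fin k → ℕ) → Dec (Equitable f)
equitable? f = all? λ a → all? λ b → f a ≤? suc (f b)

unequitable⇒gap : ∀ {k} {f : Fin k → ℕ} → ¬ Equitable f → ∃ λ a → ∃ λ b → 2 + f b ≤ f a
unequitable⇒gap {k} {f} unequitable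
  with a , ¬all ← ¬∀⟶∃¬ k _ (λ a → all? λ b → f a ≤? suc (f b)) unequitable
  with b , ¬le ← ¬∀⟶∃¬ k _ (λ b → f a ≤? suc (f b)) ¬all
  = a , b , ≰⇒> ¬le

gap⇒≢ : ∀ {k} {f : Fin k → ℕ} {a b} → 2 + f b ≤ f a → a ≢ b
gap⇒≢ {f = f} {a} gap refl = <-irrefl refl (≤-trans (n≤1+n (suc (f a))) gap)

equitable-colouring : ∀ {m k} (hs : List (Counter m)) → Rebalancer k hs → (Fin m → Fin k) →
  Σ (Fin m → Fin k) λ col → All (λ h → Equitable (tally h col)) hs
equitable-colouring {m} {k} hs rebalance col₀ = descend col₀ (<-wellFounded (potential hs col₀))
  where
  descend : ∀ col → Acc _<_ (potential hs col) → Σ (Fin m → Fin k) λ col → All (λ h → Equitable (tally h col)) hs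
  descend col (acc smaller) with All.all? (λ h → equitable? (tally h col)) hs
  ... | yes equitable = col , equitable
  ... | no ¬equitable
    with h , h∈hs , unequitable ← find (¬All⇒Any¬ (λ h → equitable? (tally h col)) hs ¬equitable)
    with a , b , gap ← unequitable⇒gap unequitable
    with r , balanced ← rebalance col (gap⇒≢ {f = tally h col} gap)
    = descend col' (smaller (potential-decrease
        (All.map (λ {h} → proj₁ ∘ squares-recolour h) balanced) h∈hs
        (proj₂ (squares-recolour h (All.lookup balanced h∈hs)) gap)))
    where open Recolouring col (gap⇒≢ {f = tally h col} gap) r

-- Rebalancing two colour classes of a digraph

data Port (n : ℕ) : Set where
  outPort inPort : Fin n → Port n
  hub : Port n

outPort-injective : ∀ {n} {u v : Fin n} → outPort u ≡ outPort v → u ≡ v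
outPort-injective refl = refl

inPort-injective : ∀ {n} {u v : Fin n} → inPort u ≡ inPort v → u ≡ v
inPort-injective refl = refl

_≟ᴾ_ : ∀ {n} → DecidableEquality (Port n)
outPort u ≟ᴾ outPort v = Dec.map′ (cong outPort) outPort-injective (u ≟ v)
inPort u ≟ᴾ inPort v = Dec.map′ (cong inPort) inPort-injective (u ≟ v)
hub ≟ᴾ hub = yes refl
outPort _ ≟ᴾ inPort _ = no λ ()
outPort _ ≟ᴾ hub = no λ ()
inPort _ ≟ᴾ outPort _ = no λ ()
inPort _ ≟ᴾ hub = no λ ()
hub ≟ᴾ outPort _ = no λ ()
hub ≟ᴾ inPort _ = no λ ()

pair-outdegree pair-indegree : (G : Digraph) {k : ℕ} → (Fin (m G) → Fin k) → Fin k → Fin k → Fin (n G) → ℕ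
pair-outdegree G col a b v = count (λ e → inPair col a b e ∧ ⌊ src G e ≟ v ⌋)
pair-indegree G col a b v = count (λ e → inPair col a b e ∧ ⌊ tgt G e ≟ v ⌋)

-- The auxiliary graph for recolouring classes a and b: every a- or b-coloured edge joins the
-- out-port of its tail to the in-port of its head, every other edge is a loop at the hub, and each
-- present vertex v gets an extra edge from its out-port to its partner (the hub, or its own in-port
-- when linked).  A balanced orientation of it colours forward edges a and reversed edges b.
module PairGraph (G : Digraph) {k} (col : Fin (m G) → Fin k) {a b : Fin k} (a≢b : a ≢ b)
                 (present : Fin (n G) → Bool) (linked : Bool) where

  open Orientation (_≟ᴾ_ {n G})

  hits-outPort : ∀ {u v} → hits (outPort u) (outPort v) ≡ toℕ ⌊ u ≟ v ⌋
  hits-outPort {u} {v} = cong toℕ (trans (isYes≗does (outPort u ≟ᴾ outPort v)) (sym (isYes≗does (u ≟ v))))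

  hits-inPort : ∀ {u v} → hits (inPort u) (inPort v) ≡ toℕ ⌊ u ≟ v ⌋
  hits-inPort {u} {v} = cong toℕ (trans (isYes≗does (inPort u ≟ᴾ inPort v)) (sym (isYes≗does (u ≟ v))))

  partner : Fin (n G) → Port (n G)
  partner v = if linked then inPort v else hub

  pair-ends : Fin (m G) → Port (n G) × Port (n G)
  pair-ends e = if inPair col a b e then (outPort (src G e) , inPort (tgt G e)) else (hub , hub)

  aux-ends : Fin (n G) → Port (n G) × Port (n G)
  aux-ends v = if present v then (outPort v , partner v) else (hub , hub)

  ends : Fin (m G + n G) → Port (n G) × Port (n G)
  ends = [ pair-ends , aux-ends ]′ ∘ splitAt (m G)

  r : Fin (m G + n G) → Bool
  r = proj₁ (balanced-orientation ends)

  H : Fin (m G + n G) → Port (n G) × Port (n G)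
  H = reorient r ends

  H-balanced : IsBalanced H
  H-balanced = proj₂ (balanced-orientation ends)

  ρ : Fin (m G) → Bool
  ρ e = r (e ↑ˡ n G)

  τ : Fin (n G) → Bool
  τ v = r (m G ↑ʳ v)

  open Recolouring col a≢b ρ public

  aux-hits : Bool → Port (n G) → Fin (n G) → ℕ
  aux-hits s w j = hits (endpoint s (orient (τ j) (aux-ends j))) w

  endcount-split : ∀ s w {X : Fin (m G) → Bool} {Y : ℕ} →
    (∀ e → hits (endpoint s (orient (ρ e) (pair-ends e))) w ≡ toℕ (X e)) →
    sum (aux-hits s w) ≡ Y →
    endcount s H w ≡ count X + Y
  endcount-split s w {X} pair-count aux-count = trans (∑-↑ (m G) _) (cong₂ _+_
    (trans (sum-cong-≗ λ e → trans (cong (λ p → hits (endpoint s (orient (ρ e) p)) w)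
                                          (cong [ pair-ends , aux-ends ]′ (splitAt-↑ˡ (m G) e (n G))))
                                   (pair-count e))
           (sym (count≡∑ X)))
    (trans (sum-cong-≗ λ j → cong (λ p → hits (endpoint s (orient (τ j) p)) w)
                                  (cong [ pair-ends , aux-ends ]′ (splitAt-↑ʳ (m G) (n G) j)))
           aux-count))

  pair-tail-at-outPort : ∀ e v → hits (endpoint false (orient (ρ e) (pair-ends e))) (outPort v) ≡ toℕ (⌊ col' e ≟ a ⌋ ∧ ⌊ src G e ≟ v ⌋)
  pair-tail-at-outPort e v rewrite recoloured-a e with inPair col a b e | ρ e
  ... | true | false = hits-outPort
  ... | true | true = refl
  ... | false | false = refl
  ... | false | true = refl

  pair-head-at-outPort : ∀ e v → hits (endpoint true (orient (ρ e) (pair-ends e))) (outPort v) ≡ toℕ (⌊ col' e ≟ b ⌋ ∧ ⌊ src G e ≟ v ⌋)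
  pair-head-at-outPort e v rewrite recoloured-b e with inPair col a b e | ρ e
  ... | true | true = hits-outPort
  ... | true | false = refl
  ... | false | false = refl
  ... | false | true = refl

  pair-head-at-inPort : ∀ e v → hits (endpoint true (orient (ρ e) (pair-ends e))) (inPort v) ≡ toℕ (⌊ col' e ≟ a ⌋ ∧ ⌊ tgt G e ≟ v ⌋)
  pair-head-at-inPort e v rewrite recoloured-a e with inPair col a b e | ρ e
  ... | true | false = hits-inPort
  ... | true | true = refl
  ... | false | false = refl
  ... | false | true = refl

  pair-tail-at-inPort : ∀ e v → hits (endpoint false (orient (ρ e) (pair-ends e))) (inPort v) ≡ toℕ (⌊ col' e ≟ b ⌋ ∧ ⌊ tgt G e ≟ v ⌋)
  pair-tail-at-inPort e v rewrite recoloured-b e with inPair col a b e | ρ e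
  ... | true | true = hits-inPort
  ... | true | false = refl
  ... | false | false = refl
  ... | false | true = refl

  pair-at-hub : ∀ s e → hits (endpoint s (orient (ρ e) (pair-ends e))) hub ≡ toℕ (not (inPair col a b e))
  pair-at-hub s e with inPair col a b e | ρ e | s
  ... | false | ρₑ | s = hits-loop s ρₑ hub hub
  ... | true | false | false = refl
  ... | true | false | true = refl
  ... | true | true | false = refl
  ... | true | true | true = refl

  aux-end : ∀ s j w → aux-hits s w j ≡ (if present j then hits (if s xor τ j then partner j else outPort j) w else hits hub w)
  aux-end s j w with present j
  ... | false = hits-loop s (τ j) hub w
  ... | true = cong (λ p → hits p w) (trans (endpoint-orient s (τ j) _) (chosen (s xor τ j)))
    where
    chosen : ∀ σ → endpoint σ (outPort j , partner j) ≡ (if σ then partner j else outPort j)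
    chosen false = refl
    chosen true = refl

  aux-at-outPort : ∀ s v → sum (aux-hits s (outPort v)) ≡ toℕ (present v ∧ (if s then τ v else not (τ v)))
  aux-at-outPort s v = trans (∑-supported-at v _ λ j j≢v → trans (aux-end s j (outPort v)) (elsewhere j≢v (present j) (s xor τ j) linked))
                             (trans (aux-end s v (outPort v)) (at-v (present v) s (τ v) linked))
    where
    elsewhere : ∀ {j} → j ≢ v → ∀ p σ L →
      (if p then hits (if σ then (if L then inPort j else hub) else outPort j) (outPort v) else hits hub (outPort v)) ≡ 0
    elsewhere j≢v false σ L = refl
    elsewhere j≢v true false L = hits-≢ (j≢v ∘ outPort-injective)
    elsewhere j≢v true true false = refl
    elsewhere j≢v true true true = refl
    at-v : ∀ p s t L → (if p then hits (if s xor t then (if L then inPort v else hub) else outPort v) (outPort v) else hits hub (outPort v))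
                     ≡ toℕ (p ∧ (if s then t else not t))
    at-v false s t L = refl
    at-v true false false L = hits-self (outPort v)
    at-v true false true false = refl
    at-v true false true true = refl
    at-v true true false false = refl
    at-v true true false true = refl
    at-v true true true L = hits-self (outPort v)

  aux-at-inPort : ∀ s v → sum (aux-hits s (inPort v)) ≡ toℕ (linked ∧ (present v ∧ (if s then not (τ v) else τ v)))
  aux-at-inPort s v = trans (∑-supported-at v _ λ j j≢v → trans (aux-end s j (inPort v)) (elsewhere j≢v (present j) (s xor τ j) linked))
                            (trans (aux-end s v (inPort v)) (at-v (present v) s (τ v) linked))
    where
    elsewhere : ∀ {j} → j ≢ v → ∀ p σ L →
      (if p then hits (if σ then (if L then inPort j else hub) else outPort j) (inPort v) else hits hub (inPort v)) ≡ 0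
    elsewhere j≢v false σ L = refl
    elsewhere j≢v true false L = refl
    elsewhere j≢v true true false = refl
    elsewhere j≢v true true true = hits-≢ (j≢v ∘ inPort-injective)
    at-v : ∀ p s t L → (if p then hits (if s xor t then (if L then inPort v else hub) else outPort v) (inPort v) else hits hub (inPort v))
                     ≡ toℕ (L ∧ (p ∧ (if s then not t else t)))
    at-v false s t false = refl
    at-v false s t true = refl
    at-v true false false false = refl
    at-v true false false true = refl
    at-v true false true false = refl
    at-v true false true true = hits-self (inPort v)
    at-v true true false false = refl
    at-v true true false true = hits-self (inPort v)
    at-v true true true false = refl
    at-v true true true true = refl

  aux-at-hub : ∀ s → sum (aux-hits s hub) ≡ ∑[ j < n G ] toℕ (not (present j)) + ∑[ j < n G ] toℕ (not linked ∧ (present j ∧ (if s then not (τ j) else τ j)))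
  aux-at-hub s = trans (sum-cong-≗ λ j → trans (aux-end s j hub) (at-j (present j) s (τ j) linked))
                       (∑-distrib-+ (λ j → toℕ (not (present j))) (λ j → toℕ (not linked ∧ (present j ∧ (if s then not (τ j) else τ j)))))
    where
    at-j : ∀ {j} p s t L → (if p then hits (if s xor t then (if L then inPort j else hub) else outPort j) hub else hits hub hub)
                         ≡ toℕ (not p) + toℕ (not L ∧ (p ∧ (if s then not t else t)))
    at-j false s t false = refl
    at-j false s t true = refl
    at-j true false false false = refl
    at-j true false false true = refl
    at-j true false true false = refl
    at-j true false true true = refl
    at-j true true false false = refl
    at-j true true false true = refl
    at-j true true true false = refl
    at-j true true true true = refl

  tails-at-outPort : ∀ v → outdegree H (outPort v) ≡ outdeg G (part G col' a) v + toℕ (present v ∧ not (τ v))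
  tails-at-outPort v = endcount-split false (outPort v) (λ e → pair-tail-at-outPort e v) (aux-at-outPort false v)

  heads-at-outPort : ∀ v → indegree H (outPort v) ≡ outdeg G (part G col' b) v + toℕ (present v ∧ τ v)
  heads-at-outPort v = endcount-split true (outPort v) (λ e → pair-head-at-outPort e v) (aux-at-outPort true v)

  heads-at-inPort : ∀ v → indegree H (inPort v) ≡ indeg G (part G col' a) v + toℕ (linked ∧ (present v ∧ not (τ v)))
  heads-at-inPort v = endcount-split true (inPort v) (λ e → pair-head-at-inPort e v) (aux-at-inPort true v)

  tails-at-inPort : ∀ v → outdegree H (inPort v) ≡ indeg G (part G col' b) v + toℕ (linked ∧ (present v ∧ τ v))
  tails-at-inPort v = endcount-split false (inPort v) (λ e → pair-tail-at-inPort e v) (aux-at-inPort false v)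

  hub-loops : ℕ
  hub-loops = count (not ∘ inPair col a b) + ∑[ j < n G ] toℕ (not (present j))

  heads-at-hub : indegree H hub ≡ hub-loops + ∑[ j < n G ] toℕ (not linked ∧ (present j ∧ not (τ j)))
  heads-at-hub = trans (endcount-split true hub (pair-at-hub true) (aux-at-hub true)) (sym (+-assoc (count (not ∘ inPair col a b)) _ _))

  tails-at-hub : outdegree H hub ≡ hub-loops + ∑[ j < n G ] toℕ (not linked ∧ (present j ∧ τ j))
  tails-at-hub = trans (endcount-split false hub (pair-at-hub false) (aux-at-hub false)) (sym (+-assoc (count (not ∘ inPair col a b)) _ _))

  outdeg-pair-split : ∀ v → outdeg G (part G col' a) v + outdeg G (part G col' b) v ≡ pair-outdegree G col a b v
  outdeg-pair-split v = count-+ λ e → subst₂ (λ α β → toℕ (α ∧ ⌊ src G e ≟ v ⌋) + toℕ (β ∧ ⌊ src G e ≟ v ⌋) ≡ _)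
    (sym (recoloured-a e)) (sym (recoloured-b e)) (split-bit-∧ʳ (inPair col a b e) (ρ e) ⌊ src G e ≟ v ⌋)

  indeg-pair-split : ∀ v → indeg G (part G col' a) v + indeg G (part G col' b) v ≡ pair-indegree G col a b v
  indeg-pair-split v = count-+ λ e → subst₂ (λ α β → toℕ (α ∧ ⌊ tgt G e ≟ v ⌋) + toℕ (β ∧ ⌊ tgt G e ≟ v ⌋) ≡ _)
    (sym (recoloured-a e)) (sym (recoloured-b e)) (split-bit-∧ʳ (inPair col a b e) (ρ e) ⌊ tgt G e ≟ v ⌋)

  outPort-balanced : ∀ v → NearlyEqual (outdeg G (part G col' a) v + toℕ (present v ∧ not (τ v)))
                                      (outdeg G (part G col' b) v + toℕ (present v ∧ τ v))
  outPort-balanced v = subst₂ NearlyEqual (tails-at-outPort v) (heads-at-outPort v) (H-balanced (outPort v))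

  inPort-balanced : ∀ v → NearlyEqual (indeg G (part G col' a) v + toℕ (linked ∧ (present v ∧ not (τ v))))
                                     (indeg G (part G col' b) v + toℕ (linked ∧ (present v ∧ τ v)))
  inPort-balanced v = NearlyEqual-sym (subst₂ NearlyEqual (tails-at-inPort v) (heads-at-inPort v) (H-balanced (inPort v)))

  hub-balanced : NearlyEqual (∑[ j < n G ] toℕ (not linked ∧ (present j ∧ not (τ j))))
                             (∑[ j < n G ] toℕ (not linked ∧ (present j ∧ τ j)))
  hub-balanced = NearlyEqual-cancelˡ hub-loops (NearlyEqual-sym (subst₂ NearlyEqual tails-at-hub heads-at-hub (H-balanced hub)))

  outPort-exact : ∀ v {t} → pair-outdegree G col a b v + toℕ (present v) ≡ t + t →
    outdeg G (part G col' a) v + toℕ (present v ∧ not (τ v)) ≡ outdeg G (part G col' b) v + toℕ (present v ∧ τ v)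
  outPort-exact v {t} even = NearlyEqual-even⇒≡ {t = t} (outPort-balanced v) (trans
    (+-interchange (outdeg G (part G col' a) v) _ _ _)
    (trans (cong₂ _+_ (outdeg-pair-split v) (split-bit (present v) (τ v))) even))

  inPort-exact : ∀ v {t} → pair-indegree G col a b v + toℕ (linked ∧ present v) ≡ t + t →
    indeg G (part G col' a) v + toℕ (linked ∧ (present v ∧ not (τ v))) ≡ indeg G (part G col' b) v + toℕ (linked ∧ (present v ∧ τ v))
  inPort-exact v {t} even = NearlyEqual-even⇒≡ {t = t} (inPort-balanced v) (trans
    (+-interchange (indeg G (part G col' a) v) _ _ _)
    (trans (cong₂ _+_ (indeg-pair-split v) (split-bit-∧ˡ linked (present v) (τ v))) even))

outCounter inCounter : (G : Digraph) → Fin (n G) → Counter (m G)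
outCounter G v e inClass = inClass ∧ ⌊ src G e ≟ v ⌋
inCounter G v e inClass = inClass ∧ ⌊ tgt G e ≟ v ⌋

sizeCounter : ∀ {m} → Counter m
sizeCounter e inClass = inClass

-- out_c(v) + (d⁻(v) - in_c(v)): the out-edges of v in class c plus the in-edges outside it.
diffCounter : (G : Digraph) → Fin (n G) → Counter (m G)
diffCounter G v e inClass = if inClass then ⌊ src G e ≟ v ⌋ else ⌊ tgt G e ≟ v ⌋

degreeCounters : (G : Digraph) → List (Counter (m G))
degreeCounters G = map (outCounter G) (allFin (n G)) ++ map (inCounter G) (allFin (n G))

degreeCounters-nearlyEqual : ∀ (G : Digraph) {k} {col : Fin (m G) → Fin k} {a b} →
  (∀ v → NearlyEqual (outdeg G (part G col a) v) (outdeg G (part G col b) v)) →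
  (∀ v → NearlyEqual (indeg G (part G col a) v) (indeg G (part G col b) v)) →
  All (λ h → NearlyEqual (tally h col a) (tally h col b)) (degreeCounters G)
degreeCounters-nearlyEqual G outs ins = ++⁺ (map⁺ (tabulate⁺ outs)) (map⁺ (tabulate⁺ ins))

degreeCounters-balanced : ∀ (G : Digraph) {k} {col : Fin (m G) → Fin k} →
  All (λ h → Equitable (tally h col)) (degreeCounters G) → Balanced k G col
degreeCounters-balanced G equitable i v =
  class-close (outCounter G v) (λ _ → refl) (All.lookup equitable (∈-++⁺ˡ (∈-map⁺ (outCounter G) (∈-allFin v)))) i ,
  class-close (inCounter G v) (λ _ → refl)
    (All.lookup equitable (∈-++⁺ʳ (map (outCounter G) (allFin (n G))) (∈-map⁺ (inCounter G) (∈-allFin v)))) i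

tally-diffCounter : ∀ G {k} (col : Fin (m G) → Fin k) v c →
  tally (diffCounter G v) col c + indeg G (part G col c) v ≡ outdeg G (part G col c) v + indeg G (all G) v
tally-diffCounter G col v c = count-+-cong pointwise
  where
  pointwise : ∀ e → toℕ (diffCounter G v e ⌊ col e ≟ c ⌋) + toℕ (⌊ col e ≟ c ⌋ ∧ ⌊ tgt G e ≟ v ⌋)
                  ≡ toℕ (⌊ col e ≟ c ⌋ ∧ ⌊ src G e ≟ v ⌋) + toℕ ⌊ tgt G e ≟ v ⌋
  pointwise e with ⌊ col e ≟ c ⌋
  ... | true = refl
  ... | false = +-identityʳ _

-- The out-ports of odd pair degree are joined to the hub, so every out-port is exactly balanced
-- and the balance at the hub bounds the difference of the totals.
module SizeRebalancing (G : Digraph) {k} (col : Fin (m G) → Fin k) {a b : Fin k} (a≢b : a ≢ b) where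

  open PairGraph G col a≢b (odd ∘ pair-outdegree G col a b) false public

  tail-bit head-bit : Fin (n G) → ℕ
  tail-bit v = toℕ (odd (pair-outdegree G col a b v) ∧ not (τ v))
  head-bit v = toℕ (odd (pair-outdegree G col a b v) ∧ τ v)

  outPort-exact′ : ∀ v → outdeg G (part G col' a) v + tail-bit v ≡ outdeg G (part G col' b) v + head-bit v
  outPort-exact′ v with t , even ← +odd-even (pair-outdegree G col a b v) = outPort-exact v {t} even

  outdeg-balanced : ∀ v → NearlyEqual (outdeg G (part G col' a) v) (outdeg G (part G col' b) v)
  outdeg-balanced v = NearlyEqual-offset (outPort-exact′ v) (NearlyEqual-bits _ _)

  indeg-balanced : ∀ v → NearlyEqual (indeg G (part G col' a) v) (indeg G (part G col' b) v)
  indeg-balanced v = subst₂ NearlyEqual (+-identityʳ _) (+-identityʳ _) (inPort-balanced v)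

  size-balanced : NearlyEqual (size G (part G col' a)) (size G (part G col' b))
  size-balanced = NearlyEqual-offset summed hub-balanced
    where
    open ≡-Reasoning
    outdegs : Fin k → Fin (n G) → ℕ
    outdegs c v = outdeg G (part G col' c) v
    summed : size G (part G col' a) + sum tail-bit ≡ size G (part G col' b) + sum head-bit
    summed = begin
      size G (part G col' a) + sum tail-bit            ≡⟨ cong (_+ sum tail-bit) (count-fibres (src G) (part G col' a)) ⟩
      sum (outdegs a) + sum tail-bit                   ≡⟨ ∑-distrib-+ (outdegs a) tail-bit ⟨
      ∑[ v < n G ] (outdegs a v + tail-bit v)          ≡⟨ sum-cong-≗ outPort-exact′ ⟩
      ∑[ v < n G ] (outdegs b v + head-bit v)          ≡⟨ ∑-distrib-+ (outdegs b) head-bit ⟩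
      sum (outdegs b) + sum head-bit                   ≡⟨ cong (_+ sum head-bit) (count-fibres (src G) (part G col' b)) ⟨
      size G (part G col' b) + sum head-bit            ∎

module DifferenceRebalancing (G : Digraph) {k} (col : Fin (m G) → Fin k) {a b : Fin k} (a≢b : a ≢ b) where

  odd-out odd-in : Fin (n G) → Bool
  odd-out v = odd (pair-outdegree G col a b v)
  odd-in v = odd (pair-indegree G col a b v)

  open PairGraph G col a≢b (λ v → odd-out v ∧ odd-in v) true public

  oa ob ia ib α β : Fin (n G) → ℕ
  oa v = outdeg G (part G col' a) v
  ob v = outdeg G (part G col' b) v
  ia v = indeg G (part G col' a) v
  ib v = indeg G (part G col' b) v
  α v = toℕ ((odd-out v ∧ odd-in v) ∧ not (τ v))
  β v = toℕ ((odd-out v ∧ odd-in v) ∧ τ v)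

  out-exact : ∀ v → odd-out v ≡ false ⊎ odd-in v ≡ true → oa v + α v ≡ ob v + β v
  out-exact v parity with t , even ← +odd-even (pair-outdegree G col a b v) = outPort-exact v {t} (subst (λ p → pair-outdegree G col a b v + toℕ p ≡ t + t) (same parity) even)
    where
    same : odd-out v ≡ false ⊎ odd-in v ≡ true → odd-out v ≡ odd-out v ∧ odd-in v
    same (inj₁ even-out) rewrite even-out = refl
    same (inj₂ odd-in-v) rewrite odd-in-v = sym (∧-identityʳ (odd-out v))

  in-exact : ∀ v → odd-in v ≡ false ⊎ odd-out v ≡ true → ia v + α v ≡ ib v + β v
  in-exact v parity with t , even ← +odd-even (pair-indegree G col a b v) = inPort-exact v {t} (subst (λ p → pair-indegree G col a b v + toℕ p ≡ t + t) (same parity) even)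
    where
    same : odd-in v ≡ false ⊎ odd-out v ≡ true → odd-in v ≡ odd-out v ∧ odd-in v
    same (inj₁ even-in) rewrite even-in = sym (∧-zeroʳ (odd-out v))
    same (inj₂ odd-out-v) rewrite odd-out-v = refl

  absent-bits : ∀ v → (odd-out v ∧ odd-in v) ≡ false → α v ≡ 0 × β v ≡ 0
  absent-bits v absent rewrite absent = refl , refl

  drop-bits : ∀ (R : ℕ → ℕ → Set) {x y v} → (odd-out v ∧ odd-in v) ≡ false → R (x + α v) (y + β v) → R x y
  drop-bits R {x} {y} {v} absent r with absent-bits v absent
  ... | α≡0 , β≡0 = subst₂ R (trans (cong (_+_ x) α≡0) (+-identityʳ x)) (trans (cong (_+_ y) β≡0) (+-identityʳ y)) r

  -- A port of odd pair degree without auxiliary edge is only nearly balanced, but at every vertex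
  -- at least one of the two ports is exact.
  vertex-balanced : ∀ v → NearlyEqual (oa v) (ob v) × NearlyEqual (ia v) (ib v) × NearlyEqual (oa v + ib v) (ob v + ia v)
  vertex-balanced v with odd-out v in parity-out | odd-in v in parity-in
  ... | true | true = NearlyEqual-offset out≡ (NearlyEqual-bits _ _) , NearlyEqual-offset in≡ (NearlyEqual-bits _ _) ,
                      NearlyEqual-reflexive (cross-sums-equal {oa v} {ob v} {ia v} {ib v} {α v} {β v} out≡ in≡)
    where
    out≡ = out-exact v (inj₂ parity-in)
    in≡ = in-exact v (inj₂ parity-out)
  ... | false | false = NearlyEqual-offset out≡ (NearlyEqual-bits _ _) , NearlyEqual-offset in≡ (NearlyEqual-bits _ _) ,
                        NearlyEqual-reflexive (cross-sums-equal {oa v} {ob v} {ia v} {ib v} {α v} {β v} out≡ in≡)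
    where
    out≡ = out-exact v (inj₁ parity-out)
    in≡ = in-exact v (inj₁ parity-in)
  ... | true | false = out≈ , NearlyEqual-reflexive ia≡ib ,
                       subst (λ x → NearlyEqual (oa v + ib v) (ob v + x)) (sym ia≡ib) (NearlyEqual-+ʳ (ib v) out≈)
    where
    absent : (odd-out v ∧ odd-in v) ≡ false
    absent = cong₂ _∧_ parity-out parity-in
    out≈ = drop-bits NearlyEqual absent (outPort-balanced v)
    ia≡ib = drop-bits _≡_ absent (in-exact v (inj₁ parity-in))
  ... | false | true = NearlyEqual-reflexive oa≡ob , in≈ ,
                       subst (λ x → NearlyEqual (x + ib v) (ob v + ia v)) (sym oa≡ob) (NearlyEqual-+ˡ (ob v) (NearlyEqual-sym in≈))
    where
    absent : (odd-out v ∧ odd-in v) ≡ false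
    absent = cong₂ _∧_ parity-out parity-in
    in≈ = drop-bits NearlyEqual absent (inPort-balanced v)
    oa≡ob = drop-bits _≡_ absent (out-exact v (inj₁ parity-out))

  diff-balanced : ∀ v → NearlyEqual (tally (diffCounter G v) col' a) (tally (diffCounter G v) col' b)
  diff-balanced v = NearlyEqual-difference (tally-diffCounter G col' v a) (tally-diffCounter G col' v b)
    (proj₂ (proj₂ (vertex-balanced v)))

size-rebalancer : ∀ (G : Digraph) {k} → Rebalancer k (sizeCounter ∷ degreeCounters G)
size-rebalancer G col a≢b = ρ , size-balanced ∷ degreeCounters-nearlyEqual G outdeg-balanced indeg-balanced
  where open SizeRebalancing G col a≢b

diff-rebalancer : ∀ (G : Digraph) {k} → Rebalancer k (degreeCounters G ++ map (diffCounter G) (allFin (n G)))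
diff-rebalancer G col a≢b =
  ρ , ++⁺ (degreeCounters-nearlyEqual G (proj₁ ∘ vertex-balanced) (proj₁ ∘ proj₂ ∘ vertex-balanced))
              (map⁺ (tabulate⁺ diff-balanced))
  where open DifferenceRebalancing G col a≢b

-- The parity condition (ii)

sum-as-multiple : ∀ (S In Out K q : ℤ) → S ℤ.+ In ≡ Out ℤ.+ K ℤ.* In → K ℤ.* q ≡ Out - In → S ≡ K ℤ.* (q ℤ.+ In)
sum-as-multiple S In Out K q S+In≡ Kq≡ = begin
  S                          ≡⟨ add-sub S In ⟩
  S ℤ.+ In - In              ≡⟨ cong (_- In) S+In≡ ⟩
  Out ℤ.+ K ℤ.* In - In      ≡⟨ regroup Out K In ⟩
  Out - In ℤ.+ K ℤ.* In      ≡⟨ cong (ℤ._+ K ℤ.* In) Kq≡ ⟨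
  K ℤ.* q ℤ.+ K ℤ.* In       ≡⟨ ZP.*-distribˡ-+ K q In ⟨
  K ℤ.* (q ℤ.+ In)           ∎
  where
  open ≡-Reasoning
  add-sub : ∀ S In → S ≡ S ℤ.+ In - In
  add-sub = ℤsolve-∀
  regroup : ∀ Out K In → Out ℤ.+ K ℤ.* In - In ≡ Out - In ℤ.+ K ℤ.* In
  regroup = ℤsolve-∀

even-difference : ∀ (o i q In t : ℤ) → t ℤ.+ i ≡ o ℤ.+ In → q ℤ.+ In ≡ t → o ℤ.+ i - q ≡ i ℤ.+ i
even-difference o i q In t t+i≡ q+In≡ = begin
  o ℤ.+ i - q                        ≡⟨ regroup o i q In ⟩
  o ℤ.+ In ℤ.+ i - (q ℤ.+ In)        ≡⟨ cong₂ (λ x y → x ℤ.+ i - y) t+i≡ (sym q+In≡) ⟨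
  t ℤ.+ i ℤ.+ i - t                  ≡⟨ cancel t i ⟩
  i ℤ.+ i                            ∎
  where
  open ≡-Reasoning
  regroup : ∀ o i q In → o ℤ.+ i - q ≡ o ℤ.+ In ℤ.+ i - (q ℤ.+ In)
  regroup = ℤsolve-∀
  cancel : ∀ t i → t ℤ.+ i ℤ.+ i - t ≡ i ℤ.+ i
  cancel = ℤsolve-∀

-- S = k(q + In) ≥ 0 makes q + In a natural number t, and the equitable x equals t.
parity-of-balanced-class : ∀ k' (q : ℤ) {Out In S x o i : ℕ} → + suc k' ℤ.* q ≡ + Out - + In →
  S + In ≡ Out + suc k' * In → Close (suc k') x S → x + i ≡ o + In → (+ 2) ℤD.∣ (+ (o + i) - q)
parity-of-balanced-class k' q {Out} {In} {S} {x} {o} {i} kq≡ S+In≡ x≈S x+i≡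
  with q ℤ.+ + In in q+In≡ | sum-as-multiple (+ S) (+ In) (+ Out) (+ suc k') q lifted kq≡
  where
  lifted : + S ℤ.+ + In ≡ + Out ℤ.+ + suc k' ℤ.* + In
  lifted = trans (sym (ZP.pos-+ S In)) (trans (cong +_ S+In≡) (trans (ZP.pos-+ Out _) (cong (ℤ._+_ (+ Out)) (ZP.pos-* (suc k') In))))
... | -[1+ j ] | ()
... | + t | S≡kt = divides i (trans (cong ℤ.∣_∣ (trans i+i≡ (sym (ZP.pos-+ i i)))) (twice i))
  where
  x≡t : x ≡ t
  x≡t = close-multiple⇒≡ (subst (Close (suc k') x) (ZP.+-injective (trans S≡kt (sym (ZP.pos-* (suc k') t)))) x≈S)
  i+i≡ : + (o + i) - q ≡ + i ℤ.+ + i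
  i+i≡ = trans (cong (_- q) (ZP.pos-+ o i)) (even-difference (+ o) (+ i) q (+ In) (+ t)
           (trans (sym (ZP.pos-+ t i)) (trans (cong +_ (subst (λ z → z + i ≡ o + In) x≡t x+i≡)) (ZP.pos-+ o In))) q+In≡)
  twice : ∀ i → i + i ≡ i * 2
  twice = solve-∀

balanced⇒degree-close : ∀ {k} (G : Digraph) {col : Decomp k G} → Balanced k G col → ∀ i v →
  (k ∣ outdeg G (all G) v) ⊎ (k ∣ indeg G (all G) v) → Close k (deg G (part G col i) v) (deg G (all G) v)
balanced⇒degree-close G balanced i v k∣ = close-+ k∣ (proj₁ (balanced i v)) (proj₂ (balanced i v))

size-equitable-colouring : ∀ k' (G : Digraph) → Σ (Decomp (suc k') G) λ col → Balanced (suc k') G col ×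
  (∀ i → Close (suc k') (size G (part G col i)) (m G))
size-equitable-colouring k' G
  with col , size-equitable ∷ degrees-equitable ←
         equitable-colouring (sizeCounter ∷ degreeCounters G) (size-rebalancer G) (λ _ → zero)
  = col , degreeCounters-balanced G degrees-equitable ,
    λ i → subst (Close (suc k') _) (count-all (m G)) (class-close (sizeCounter {m G}) (λ _ → refl) size-equitable i)

difference-equitable-colouring : ∀ k' (G : Digraph) → Σ (Decomp (suc k') G) λ col → Balanced (suc k') G col ×
  (∀ i u q → + suc k' ℤ.* q ≡ + outdeg G (all G) u - + indeg G (all G) u → (+ 2) ℤD.∣ (+ deg G (part G col i) u - q))
difference-equitable-colouring k' G
  with col , equitable ← equitable-colouring (degreeCounters G ++ map (diffCounter G) (allFin (n G))) (diff-rebalancer G) (λ _ → zero)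
  with degrees-equitable , differences-equitable ← ++⁻ (degreeCounters G) equitable
  = col , degreeCounters-balanced G degrees-equitable , λ i u q kq≡out-in →
    parity-of-balanced-class k' q kq≡out-in (∑-tally (diffCounter G u) col)
      (equitable⇒close (All.lookup differences-equitable (∈-map⁺ (diffCounter G) (∈-allFin u))) i)
      (tally-diffCounter G col u i)

theorem2p1 : (k : ℕ) → 1 ≤ k → (G : Digraph) →
    (Σ (Decomp k G) λ col → Balanced k G col ×
      (∀ (i : Fin k) (v : Fin (n G)) →
        (k ∣ outdeg G (all G) v) ⊎ (k ∣ indeg G (all G) v) →
        Close k (deg G (part G col i) v) (deg G (all G) v)))
    ×
    (Σ (Decomp k G) λ col → Balanced k G col ×
      (∀ (i : Fin k) → Close k (size G (part G col i)) (m G)))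
    ×
    (Σ (Decomp k G) λ col → Balanced k G col ×
      (∀ (i : Fin k) (u : Fin (n G)) (q : ℤ) →
        + k ℤ.* q ≡ + outdeg G (all G) u - + indeg G (all G) u →
        (+ 2) ℤD.∣ (+ deg G (part G col i) u - q)))
theorem2p1 zero () G
theorem2p1 (suc k') _ G =
  (proj₁ size-colouring , proj₁ (proj₂ size-colouring) , balanced⇒degree-close G (proj₁ (proj₂ size-colouring))) ,
  size-colouring ,
  difference-equitable-colouring k' G
  where
  size-colouring = size-equitable-colouring k' G
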